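{- Let $s,t,v$ be positive integers with $s<t$. If there exists an OA$(s,t,v)$, then there exists an AOA$(s,t,t,v)$.
   Context: An orthogonal array OA$(t,k,v)$ is a $v^t\times k$ array with entries from a set $X$ of size $v$ such that the restriction to any $t$ columns contains every $t$-tuple of $X^t$ exactly once. An AOA$(s,t,k,v)$ is a $v^t\times (k+1)$ array $A$ such that: (1) the first $k$ columns form an OA$(t,k,v)$ on a set $X$ with $|X|=v$; (2) the last column has symbols from a set $Y$ with $|Y|=v^{t-s}$; (3) any $s$ of the first $k$ columns together with the last column contain every $(s+1)$-tuple of $X^s\times Y$ exactly once. -}

module Defs where

open import Data.Nat using (ℕ; _^_; _∸_)
open import Data.Fin using (Fin)
open import Data.Product using (Σ; _×_)
open import Function.Definitions using (Injective)
open import Relation.Binary.PropositionalEquality using (_≡_)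

ExactlyOne : {N : ℕ} → (Fin N → Set) → Set
ExactlyOne {N} P = Σ (Fin N) λ r → P r × (∀ r' → P r' → r' ≡ r)

Array : (N k v : ℕ) → Set
Array N k v = Fin N → Fin k → Fin v

IsOA : (t k v : ℕ) → Array (v ^ t) k v → Set
IsOA t k v A =
  (c : Fin t → Fin k) → Injective _≡_ _≡_ c →
  (x : Fin t → Fin v) →
  ExactlyOne (λ r → ∀ i → A r (c i) ≡ x i)

OA : (t k v : ℕ) → Set
OA t k v = Σ (Array (v ^ t) k v) (IsOA t k v)

-- AOA(s,t,k,v): a v^t × (k+1) array, given as its first k columns A
-- (symbols X = Fin v) and its last column B (symbols Y = Fin (v^(t-s))).
AOA : (s t k v : ℕ) → Set
AOA s t k v =
  Σ (Array (v ^ t) k v) λ A →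
  Σ (Fin (v ^ t) → Fin (v ^ (t ∸ s))) λ B →
    IsOA t k v A ×
    ((c : Fin s → Fin k) → Injective _≡_ _≡_ c →
     (x : Fin s → Fin v) → (y : Fin (v ^ (t ∸ s))) →
     ExactlyOne (λ r → (∀ i → A r (c i) ≡ x i) × B r ≡ y))

-- Let d = t − s and let M be an OA(s,t,v).  The v^t rows of the AOA are all t-tuples u
-- over ℤ_v, and the last column records u − M_m on the last d coordinates, where m is the
-- unique row of M that agrees with u on the first s coordinates.  The rows whose last
-- entry is a given w ∈ ℤ_v^d are then exactly the rows of M translated by (0, w), and a
-- translate of an OA(s,t,v) is again an OA(s,t,v).
module Submission where

open import Defs
open import Data.Nat using (ℕ; zero; suc; _+_; _∸_; _^_; _≤_; _<_)
open import Data.Nat.Properties using (+-comm; +-assoc; m+[n∸m]≡n; m∸n+n≡m; <⇒≤; m+n∸m≡n; m≤n⇒∃[o]m+o≡n; 1+n≰n)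
open import Data.Nat.DivMod using (_%_; m%n<n; %-distribˡ-+; m%n%n≡m%n; [m+n]%n≡m%n; m<n⇒m%n≡m)
open import Data.Fin using (Fin; zero; suc; toℕ; fromℕ<; punchOut; combine; _↑ˡ_; _↑ʳ_; splitAt; finToFun; funToFin)
open import Data.Fin.Properties using (toℕ-injective; toℕ<n; toℕ-fromℕ<; fromℕ<-cong; punchOut-injective; any?; _≟_; injective⇒≤; ↑ˡ-injective; splitAt-↑ˡ; splitAt-↑ʳ; splitAt⁻¹-↑ˡ; splitAt⁻¹-↑ʳ; finToFun-funToFin; funToFin-finToFin)
open import Data.Product using (Σ; ∃; _×_; _,_; proj₁; proj₂)
open import Data.Sum using (_⊎_; inj₁; inj₂)
open import Function using (id; _∘_)
open import Function.Definitions using (Injective; Surjective)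
open import Relation.Binary.PropositionalEquality using (_≡_; _≢_; _≗_; refl; sym; trans; cong; cong₂; subst; module ≡-Reasoning)
open import Relation.Nullary using (yes; no; contradiction)

module CyclicGroup (n : ℕ) where
  open ≡-Reasoning

  private
    N : ℕ
    N = suc n

  reduce : ℕ → Fin N
  reduce m = fromℕ< (m%n<n m N)

  reduce-cong : ∀ m m' → m % N ≡ m' % N → reduce m ≡ reduce m'
  reduce-cong m m' eq = fromℕ<-cong (m % N) (m' % N) eq (m%n<n m N) (m%n<n m' N)

  reduce-toℕ : ∀ a → reduce (toℕ a) ≡ a
  reduce-toℕ a = toℕ-injective (trans (toℕ-fromℕ< (m%n<n (toℕ a) N)) (m<n⇒m%n≡m (toℕ<n a)))

  reduce-toℕ+N : ∀ a → reduce (toℕ a + N) ≡ a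
  reduce-toℕ+N a = trans (reduce-cong (toℕ a + N) (toℕ a) ([m+n]%n≡m%n (toℕ a) N)) (reduce-toℕ a)

  reduce-+ : ∀ m k → reduce (toℕ (reduce m) + k) ≡ reduce (m + k)
  reduce-+ m k = reduce-cong (toℕ (reduce m) + k) (m + k) (begin
    (toℕ (reduce m) + k) % N    ≡⟨ cong (λ z → (z + k) % N) (toℕ-fromℕ< (m%n<n m N)) ⟩
    (m % N + k) % N             ≡⟨ %-distribˡ-+ (m % N) k N ⟩
    (m % N % N + k % N) % N     ≡⟨ cong (λ z → (z + k % N) % N) (m%n%n≡m%n m N) ⟩
    (m % N + k % N) % N         ≡⟨ %-distribˡ-+ m k N ⟨
    (m + k) % N                 ∎)

  infixl 6 _⊕_ _⊖_

  _⊕_ : Fin N → Fin N → Fin N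
  a ⊕ b = reduce (toℕ a + toℕ b)

  _⊖_ : Fin N → Fin N → Fin N
  a ⊖ b = reduce (toℕ a + (N ∸ toℕ b))

  ⊕-comm : ∀ a b → a ⊕ b ≡ b ⊕ a
  ⊕-comm a b = cong reduce (+-comm (toℕ a) (toℕ b))

  ⊕-⊖-cancel : ∀ a b → a ⊕ b ⊖ b ≡ a
  ⊕-⊖-cancel a b = begin
    reduce (toℕ (a ⊕ b) + (N ∸ toℕ b))     ≡⟨ reduce-+ (toℕ a + toℕ b) (N ∸ toℕ b) ⟩
    reduce (toℕ a + toℕ b + (N ∸ toℕ b))   ≡⟨ cong reduce (+-assoc (toℕ a) (toℕ b) (N ∸ toℕ b)) ⟩
    reduce (toℕ a + (toℕ b + (N ∸ toℕ b))) ≡⟨ cong (λ z → reduce (toℕ a + z)) (m+[n∸m]≡n (<⇒≤ (toℕ<n b))) ⟩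
    reduce (toℕ a + N)                     ≡⟨ reduce-toℕ+N a ⟩
    a                                      ∎

  ⊖-⊕-cancel : ∀ a b → a ⊖ b ⊕ b ≡ a
  ⊖-⊕-cancel a b = begin
    reduce (toℕ (a ⊖ b) + toℕ b)           ≡⟨ reduce-+ (toℕ a + (N ∸ toℕ b)) (toℕ b) ⟩
    reduce (toℕ a + (N ∸ toℕ b) + toℕ b)   ≡⟨ cong reduce (+-assoc (toℕ a) (N ∸ toℕ b) (toℕ b)) ⟩
    reduce (toℕ a + ((N ∸ toℕ b) + toℕ b)) ≡⟨ cong (λ z → reduce (toℕ a + z)) (m∸n+n≡m (<⇒≤ (toℕ<n b))) ⟩
    reduce (toℕ a + N)                     ≡⟨ reduce-toℕ+N a ⟩
    a                                      ∎

funToFin-cong : ∀ {m n} {f g : Fin m → Fin n} → f ≗ g → funToFin f ≡ funToFin g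
funToFin-cong {zero}  _   = refl
funToFin-cong {suc m} f≗g = cong₂ combine (f≗g zero) (funToFin-cong (f≗g ∘ suc))

finToFun≗⇒≡funToFin : ∀ {m n} (r : Fin (n ^ m)) {u : Fin m → Fin n} → finToFun r ≗ u → r ≡ funToFin u
finToFun≗⇒≡funToFin {m} r r≗u = trans (sym (funToFin-finToFin {m} r)) (funToFin-cong r≗u)

injective⇒surjective : ∀ {n} {f : Fin n → Fin n} → Injective _≡_ _≡_ f → Surjective _≡_ _≡_ f
injective⇒surjective {suc m} {f} f-inj y with any? (λ i → f i ≟ y)
... | yes (i , fi≡y) = i , λ { refl → fi≡y }
... | no ∄i = contradiction (injective⇒≤ g-inj) 1+n≰n
  where
  y≢f : ∀ i → y ≢ f i
  y≢f i y≡fi = ∄i (i , sym y≡fi)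

  g : Fin (suc m) → Fin m
  g i = punchOut (y≢f i)

  g-inj : Injective _≡_ _≡_ g
  g-inj {i} {j} = f-inj ∘ punchOut-injective (y≢f i) (y≢f j)

ExactlyOne-image : ∀ {m n} {Q : Fin m → Set} {P : Fin n → Set} (f : Fin m → Fin n) →
                   (∀ i → Q i → P (f i)) → (∀ r → P r → ∃ λ i → Q i × r ≡ f i) →
                   ExactlyOne Q → ExactlyOne P
ExactlyOne-image f Q⇒P P⇒Q (i , qi , unique) =
  f i , Q⇒P i qi , λ r pr → let j , qj , r≡fj = P⇒Q r pr in trans r≡fj (cong f (unique j qj))

ExactlyOne-⇔ : ∀ {n} {P Q : Fin n → Set} → (∀ r → P r → Q r) → (∀ r → Q r → P r) →
               ExactlyOne P → ExactlyOne Q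
ExactlyOne-⇔ P⇒Q Q⇒P = ExactlyOne-image id P⇒Q (λ r qr → r , Q⇒P r qr , refl)

IsOA-relabel : ∀ {t k v} (σ σ⁻¹ : Fin k → Fin v → Fin v) →
               (∀ j a → σ j (σ⁻¹ j a) ≡ a) → (∀ j a → σ⁻¹ j (σ j a) ≡ a) →
               ∀ {M} → IsOA t k v M → IsOA t k v (λ r j → σ j (M r j))
IsOA-relabel σ σ⁻¹ σ∘σ⁻¹ σ⁻¹∘σ {M} M-isOA c c-inj x =
  ExactlyOne-⇔ relabelled unrelabelled (M-isOA c c-inj (λ i → σ⁻¹ (c i) (x i)))
  where
  relabelled : ∀ r → (∀ i → M r (c i) ≡ σ⁻¹ (c i) (x i)) → ∀ i → σ (c i) (M r (c i)) ≡ x i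
  relabelled r h i = trans (cong (σ (c i)) (h i)) (σ∘σ⁻¹ (c i) (x i))

  unrelabelled : ∀ r → (∀ i → σ (c i) (M r (c i)) ≡ x i) → ∀ i → M r (c i) ≡ σ⁻¹ (c i) (x i)
  unrelabelled r h i = trans (sym (σ⁻¹∘σ (c i) (M r (c i)))) (cong (σ⁻¹ (c i)) (h i))

finToFun-isOA : ∀ {t v} → IsOA t t v finToFun
finToFun-isOA {t} {v} c c-inj x = funToFin u , u-fits , unique
  where
  c⁻¹ : Fin t → Fin t
  c⁻¹ k = proj₁ (injective⇒surjective c-inj k)

  c∘c⁻¹ : ∀ k → c (c⁻¹ k) ≡ k
  c∘c⁻¹ k = proj₂ (injective⇒surjective c-inj k) refl

  u : Fin t → Fin v
  u = x ∘ c⁻¹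

  u-fits : ∀ i → finToFun (funToFin u) (c i) ≡ x i
  u-fits i = trans (finToFun-funToFin u (c i)) (cong x (c-inj (c∘c⁻¹ (c i))))

  unique : ∀ r → (∀ i → finToFun r (c i) ≡ x i) → r ≡ funToFin u
  unique r h = finToFun≗⇒≡funToFin r λ k → trans (cong (finToFun r) (sym (c∘c⁻¹ k))) (h (c⁻¹ k))

IsAugmentingColumn : (s : ℕ) {N k v m : ℕ} → (Fin N → Fin k → Fin v) → (Fin N → Fin m) → Set
IsAugmentingColumn s {k = k} {v} {m} A B =
  (c : Fin s → Fin k) → Injective _≡_ _≡_ c →
  (x : Fin s → Fin v) → (y : Fin m) →
  ExactlyOne (λ r → (∀ i → A r (c i) ≡ x i) × B r ≡ y)

module Augmentation (s d n : ℕ) (M : Array (suc n ^ s) (s + d) (suc n))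
                    (M-isOA : IsOA s (s + d) (suc n) M) where
  open CyclicGroup n

  private
    v t : ℕ
    v = suc n
    t = s + d

  head : Fin s → Fin t
  head i = i ↑ˡ d

  tail : Fin d → Fin t
  tail j = s ↑ʳ j

  head-or-tail : {P : Fin t → Set} → (∀ i → P (head i)) → (∀ j → P (tail j)) → ∀ k → P k
  head-or-tail {P} P-head P-tail k with splitAt s k in eq
  ... | inj₁ i = subst P (splitAt⁻¹-↑ˡ eq) (P-head i)
  ... | inj₂ j = subst P (splitAt⁻¹-↑ʳ eq) (P-tail j)

  rowOf : (Fin t → Fin v) → Fin (v ^ s)
  rowOf u = proj₁ (M-isOA head (↑ˡ-injective d _ _) (u ∘ head))

  rowOf-agrees : ∀ u i → M (rowOf u) (head i) ≡ u (head i)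
  rowOf-agrees u = proj₁ (proj₂ (M-isOA head (↑ˡ-injective d _ _) (u ∘ head)))

  rowOf-unique : ∀ u m → (∀ i → M m (head i) ≡ u (head i)) → m ≡ rowOf u
  rowOf-unique u = proj₂ (proj₂ (M-isOA head (↑ˡ-injective d _ _) (u ∘ head)))

  lastColumn : Fin (v ^ t) → Fin (v ^ d)
  lastColumn r = funToFin λ j → u (tail j) ⊖ M (rowOf u) (tail j)
    where u = finToFun r

  shift : (Fin d → Fin v) → Fin s ⊎ Fin d → Fin v → Fin v
  shift w (inj₁ _) a = a
  shift w (inj₂ j) a = a ⊕ w j

  unshift : (Fin d → Fin v) → Fin s ⊎ Fin d → Fin v → Fin v
  unshift w (inj₁ _) a = a
  unshift w (inj₂ j) a = a ⊖ w j

  shift-unshift : ∀ w p a → shift w p (unshift w p a) ≡ a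
  shift-unshift w (inj₁ _) a = refl
  shift-unshift w (inj₂ j) a = ⊖-⊕-cancel a (w j)

  unshift-shift : ∀ w p a → unshift w p (shift w p a) ≡ a
  unshift-shift w (inj₁ _) a = refl
  unshift-shift w (inj₂ j) a = ⊕-⊖-cancel a (w j)

  translate : (Fin d → Fin v) → Fin (v ^ s) → Fin t → Fin v
  translate w m k = shift w (splitAt s k) (M m k)

  translate-isOA : ∀ w → IsOA s t v (translate w)
  translate-isOA w = IsOA-relabel (shift w ∘ splitAt s) (unshift w ∘ splitAt s)
                                  (shift-unshift w ∘ splitAt s) (unshift-shift w ∘ splitAt s) {M} M-isOA

  translate-head : ∀ w m i → translate w m (head i) ≡ M m (head i)
  translate-head w m i = cong (λ p → shift w p (M m (head i))) (splitAt-↑ˡ s i d)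

  translate-tail : ∀ w m j → translate w m (tail j) ≡ M m (tail j) ⊕ w j
  translate-tail w m j = cong (λ p → shift w p (M m (tail j))) (splitAt-↑ʳ s d j)

  lastColumn-translate : ∀ w m → lastColumn (funToFin (translate w m)) ≡ funToFin w
  lastColumn-translate w m = funToFin-cong λ j → begin
    u (tail j) ⊖ M (rowOf u) (tail j)      ≡⟨ cong₂ _⊖_ (finToFun-funToFin (translate w m) (tail j))
                                                         (cong (λ m' → M m' (tail j)) (sym m≡rowOf)) ⟩
    translate w m (tail j) ⊖ M m (tail j)  ≡⟨ cong (_⊖ M m (tail j)) (translate-tail w m j) ⟩
    M m (tail j) ⊕ w j ⊖ M m (tail j)      ≡⟨ cong (_⊖ M m (tail j)) (⊕-comm (M m (tail j)) (w j)) ⟩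
    w j ⊕ M m (tail j) ⊖ M m (tail j)      ≡⟨ ⊕-⊖-cancel (w j) (M m (tail j)) ⟩
    w j                                    ∎
    where
    open ≡-Reasoning
    u = finToFun (funToFin (translate w m))
    m≡rowOf : m ≡ rowOf u
    m≡rowOf = rowOf-unique u m λ i →
      sym (trans (finToFun-funToFin (translate w m) (head i)) (translate-head w m i))

  lastColumn⇒translate : ∀ r y → lastColumn r ≡ y →
                         finToFun r ≗ translate (finToFun y) (rowOf (finToFun r))
  lastColumn⇒translate r y lastColumn≡y = head-or-tail on-head on-tail
    where
    open ≡-Reasoning
    u = finToFun r
    m = rowOf u
    w = finToFun y

    on-head : ∀ i → u (head i) ≡ translate w m (head i)
    on-head i = trans (sym (rowOf-agrees u i)) (sym (translate-head w m i))

    on-tail : ∀ j → u (tail j) ≡ translate w m (tail j)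
    on-tail j = begin
      u (tail j)                                   ≡⟨ ⊖-⊕-cancel (u (tail j)) (M m (tail j)) ⟨
      u (tail j) ⊖ M m (tail j) ⊕ M m (tail j)     ≡⟨ ⊕-comm (u (tail j) ⊖ M m (tail j)) (M m (tail j)) ⟩
      M m (tail j) ⊕ (u (tail j) ⊖ M m (tail j))   ≡⟨ cong (M m (tail j) ⊕_) w≡ ⟨
      M m (tail j) ⊕ w j                           ≡⟨ translate-tail w m j ⟨
      translate w m (tail j)                       ∎
      where
      w≡ : w j ≡ u (tail j) ⊖ M m (tail j)
      w≡ = trans (cong (λ y' → finToFun y' j) (sym lastColumn≡y))
                 (finToFun-funToFin (λ j' → u (tail j') ⊖ M m (tail j')) j)

  lastColumn-isAugmenting : IsAugmentingColumn s (finToFun {v} {t}) lastColumn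
  lastColumn-isAugmenting c c-inj x y =
    ExactlyOne-image (funToFin ∘ translate w) in-block block-row (translate-isOA w c c-inj x)
    where
    w = finToFun y

    in-block : ∀ m → (∀ i → translate w m (c i) ≡ x i) →
               (∀ i → finToFun (funToFin (translate w m)) (c i) ≡ x i) × lastColumn (funToFin (translate w m)) ≡ y
    in-block m fits = (λ i → trans (finToFun-funToFin (translate w m) (c i)) (fits i))
                    , trans (lastColumn-translate w m) (funToFin-finToFin {d} y)

    block-row : ∀ r → (∀ i → finToFun r (c i) ≡ x i) × lastColumn r ≡ y →
                ∃ λ m → (∀ i → translate w m (c i) ≡ x i) × r ≡ funToFin (translate w m)
    block-row r (fits , lastColumn≡y) =
      rowOf (finToFun r) , (λ i → trans (sym (r≗ (c i))) (fits i)) , finToFun≗⇒≡funToFin r r≗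
      where r≗ = lastColumn⇒translate r y lastColumn≡y

theorem2p5 : (s t v : ℕ) → 1 ≤ s → s < t → 1 ≤ v →
    OA s t v → AOA s t t v
theorem2p5 s t (suc n) _ s<t _ (M , M-isOA) with d , refl ← m≤n⇒∃[o]m+o≡n (<⇒≤ s<t) =
  finToFun , proj₁ column , finToFun-isOA , proj₂ column
  where
  open Augmentation s d n M M-isOA
  column : Σ (Fin (suc n ^ (s + d)) → Fin (suc n ^ (s + d ∸ s))) (IsAugmentingColumn s (finToFun {suc n} {s + d}))
  column = subst (λ e → Σ (Fin (suc n ^ (s + d)) → Fin (suc n ^ e)) (IsAugmentingColumn s (finToFun {suc n} {s + d})))
                 (sym (m+n∸m≡n s d)) (lastColumn , lastColumn-isAugmenting)
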